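{- For any $m$-colored poset $P$ and any totally ordered countable set $S$, the set of all $m$-colored $P$-partitions is the disjoint union of the sets of $m$-colored $\pi$-partitions over all linear extensions $\pi$ of $P$: \[\mathcal{A}^{(m)}(P) = \coprod_{\pi \in \mathcal{L}(P)} \mathcal{A}^{(m)}(\pi).\]
   Context: Fix $m\ge1$, let $\omega$ be a primitive $m$th root of unity. For a totally ordered countable set $S=\{s_1<s_2<\cdots\}$, let $S_m=S\times\{1,\omega,\ldots,\omega^{m-1}\}$, with elements written $\omega^js$ and total order $s_1<\omega s_1<\cdots<\omega^{m-1}s_1<s_2<\omega s_2<\cdots$; the color of $\omega^js$ is $\varepsilon(\omega^js)=j$. $\mathbb{P}_m$ is $S_m$ for $S=\mathbb{P}=\{1,2,\ldots\}$. An $m$-colored poset is a finite subset $P\subset\mathbb{P}_m$ whose elements have distinct underlying integers, equipped with a partial order $<_P$. A linear extension of $P$ is a total order on $P$ extending $<_P$; $\mathcal{L}(P)$ is the set of linear extensions, each regarded as an $m$-colored poset (a chain) on the same elements. An $m$-colored $P$-partition is a map $f:P\to S_m$ such that (1) $\varepsilon(i)=\varepsilon(f(i))$ for all $i\in P$, (2) $f(i)\le f(j)$ whenever $i<_Pj$, and (3) $f(i)<f(j)$ whenever $i<_Pj$ and $i>j$ in $\mathbb{P}_m$. $\mathcal{A}^{(m)}(P)$ denotes the set of $m$-colored $P$-partitions into $S_m$. -}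

module Defs where

open import Level using (Level; _⊔_)
open import Data.Nat using (ℕ; _≤_) renaming (_<_ to _<ℕ_)
open import Data.Fin using (Fin) renaming (_<_ to _<F_)
open import Data.Vec using (Vec; lookup)
open import Data.Product using (Σ; _×_; _,_; proj₁; proj₂; ∃)
open import Data.Sum using (_⊎_)
open import Relation.Binary.PropositionalEquality using (_≡_)
open import Relation.Binary.Bundles using (StrictTotalOrder)
open import Relation.Binary.Structures using (IsStrictPartialOrder)

-- Elements of ℙ_m : ω^j s is represented by the pair (s , j), s ∈ ℕ with s ≥ 1.
ℙm : ℕ → Set
ℙm m = ℕ × Fin m

_<ℙ_ : ∀ {m} → ℙm m → ℙm m → Set
(s , a) <ℙ (t , b) = (s <ℕ t) ⊎ ((s ≡ t) × (a <F b))

module Colored {c ℓ₁ ℓ₂} (S : StrictTotalOrder c ℓ₁ ℓ₂) (m : ℕ) where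
  open StrictTotalOrder S renaming (Carrier to A; _<_ to _<S_; _≈_ to _≈S_)

  -- S_m = S × {1, ω, …, ω^{m-1}} ; ω^j s is (s , j) and its colour is j.
  Sm : Set c
  Sm = A × Fin m

  _<Sm_ : Sm → Sm → Set (ℓ₁ ⊔ ℓ₂)
  (s , a) <Sm (t , b) = (s <S t) ⊎ ((s ≈S t) × (a <F b))

  _≤Sm_ : Sm → Sm → Set (ℓ₁ ⊔ ℓ₂)
  (s , a) ≤Sm (t , b) = (s <S t) ⊎ ((s ≈S t) × (a <F b ⊎ a ≡ b))

  -- An m-coloured P-partition, where the elements of P are indexed by Fin n,
  -- labelled in ℙ_m by lab, with strict order relation R (i <_P j).
  record IsPPartition {n ℓ} (lab : Fin n → ℙm m) (R : Fin n → Fin n → Set ℓ)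
                      (f : Fin n → Sm) : Set (ℓ ⊔ ℓ₁ ⊔ ℓ₂) where
    field
      colour : ∀ i → proj₂ (f i) ≡ proj₂ (lab i)
      weak   : ∀ i j → R i j → f i ≤Sm f j
      strict : ∀ i j → R i j → lab j <ℙ lab i → f i <Sm f j

ChainRel : ∀ {n} → Vec (Fin n) n → Fin n → Fin n → Set
ChainRel w i j = Σ _ λ a → Σ _ λ b → (a <F b) × (lookup w a ≡ i) × (lookup w b ≡ j)

-- w is a linear extension of R: w lists every element exactly once
-- (injective, hence bijective on Fin n) and the chain order extends R.
record IsLinearExtension {n ℓ} (R : Fin n → Fin n → Set ℓ) (w : Vec (Fin n) n) : Set ℓ where
  field
    injective : ∀ a b → lookup w a ≡ lookup w b → a ≡ b
    extends   : ∀ i j → R i j → ChainRel w i j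

record IsColoredPoset {n ℓ} (m : ℕ) (lab : Fin n → ℙm m) (R : Fin n → Fin n → Set ℓ) : Set ℓ where
  field
    positive  : ∀ i → 1 ≤ proj₁ (lab i)
    distinct  : ∀ i j → proj₁ (lab i) ≡ proj₁ (lab j) → i ≡ j
    partial   : IsStrictPartialOrder _≡_ R

module Submission where

-- A P-partition f induces a strict total order ≺ on P: compare the values of f in S_m and break
-- ties by the underlying integers of the labels, which are distinct.  Conditions (2) and (3)
-- for a relation R say precisely that R ⊆ ≺, so f is a π-partition for a chain π exactly when
-- π lists P in ≺-increasing order.  Hence the unique compatible linear extension is P sorted by
-- ≺ (each element placed at its number of ≺-predecessors), and it extends <_P because f is a
-- P-partition.

open import Defs
open import Level using (Level)
open import Data.Nat using (ℕ; _≤_)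
open import Data.Fin using (Fin)
open import Data.Vec using (Vec)
open import Data.Product using (Σ; _×_; ∃)
open import Relation.Binary.PropositionalEquality using (_≡_)
open import Relation.Binary.Bundles using (StrictTotalOrder)

open import Function using (_∘_; _on_)
open import Function.Definitions using (Injective)
open import Data.Nat using (zero; suc) renaming (_<_ to _<ℕ_)
import Data.Nat.Properties as ℕ
open import Data.Fin using (fromℕ<; punchOut) renaming (_<_ to _<F_)
import Data.Fin.Properties as Fin
open import Data.Fin.Induction using (<-wellFounded)
open import Data.Fin.Subset using (Subset; _∈_; _∉_; _⊂_; ⊤; ∣_∣)
open import Data.Fin.Subset.Properties using (∈⊤; ∣⊤∣≡n; p⊂q⇒∣p∣<∣q∣)
open import Data.Vec using (lookup; tabulate)
open import Data.Vec.Properties using (lookup∘tabulate; tabulate∘lookup; tabulate-cong; []=⇒lookup; lookup⇒[]=)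
open import Data.Product using (_,_; proj₁; proj₂)
open import Data.Product.Relation.Binary.Pointwise.NonDependent using (Pointwise)
open import Data.Product.Relation.Binary.Lex.Strict using (×-Lex; ×-isStrictTotalOrder)
open import Data.Sum using (inj₁; inj₂)
open import Data.Bool using (true)
open import Relation.Nullary using (¬_; Dec; yes; no; does; contradiction)
open import Relation.Nullary.Decidable using (dec-true)
open import Relation.Binary.Core using (Rel)
open import Relation.Binary.Definitions using (Trichotomous; tri<; tri≈; tri>)
open import Relation.Binary.Structures using (IsStrictTotalOrder; IsStrictPartialOrder)
open import Relation.Binary.PropositionalEquality
  using (_≢_; refl; sym; trans; cong; subst; subst₂; resp₂; module ≡-Reasoning)
import Relation.Binary.PropositionalEquality as ≡
import Relation.Binary.Construct.On as On
open import Induction.WellFounded using (Acc; acc)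

injective⇒surjective : ∀ {n} {h : Fin n → Fin n} → Injective _≡_ _≡_ h → ∀ y → ∃ λ x → h x ≡ y
injective⇒surjective {zero}  _ ()
injective⇒surjective {suc k} {h} h-injective y with Fin.any? (λ x → h x Fin.≟ y)
... | yes hit = hit
... | no miss = contradiction (Fin.injective⇒≤ h′-injective) ℕ.1+n≰n
  where
  h′ : Fin (suc k) → Fin k
  h′ x = punchOut {i = y} λ y≡hx → miss (x , sym y≡hx)

  h′-injective : Injective _≡_ _≡_ h′
  h′-injective = h-injective ∘ Fin.punchOut-injective {i = y} _ _

does⇒witness : ∀ {a} {A : Set a} (a? : Dec A) → does a? ≡ true → A
does⇒witness (yes a) _ = a

isStrictTotalOrder-≡ : ∀ {a ℓ ℓ′} {A : Set a} {_≈_ : Rel A ℓ} {_<_ : Rel A ℓ′} →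
                       IsStrictTotalOrder _≈_ _<_ → (∀ {x y} → x ≈ y → x ≡ y) →
                       IsStrictTotalOrder _≡_ _<_
isStrictTotalOrder-≡ {_<_ = _<_} sto ≈⇒≡ = record
  { isStrictPartialOrder = record
    { isEquivalence = ≡.isEquivalence
    ; irrefl        = λ { refl → irrefl Eq.refl }
    ; trans         = <-trans
    ; <-resp-≈      = resp₂ _<_
    }
  ; compare = compare′
  }
  where
  open IsStrictTotalOrder sto using (compare; irrefl; module Eq) renaming (trans to <-trans)
  compare′ : Trichotomous _≡_ _<_
  compare′ x y with compare x y
  ... | tri< x<y x≉y y≮x = tri< x<y (x≉y ∘ Eq.reflexive) y≮x
  ... | tri≈ x≮y x≈y y≮x = tri≈ x≮y (≈⇒≡ x≈y) y≮x
  ... | tri> x≮y x≉y y<x = tri> x≮y (x≉y ∘ Eq.reflexive) y<x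

ChainRel-irrefl : ∀ {n} (w : Vec (Fin n) n) → (∀ a b → lookup w a ≡ lookup w b → a ≡ b) →
                  ∀ {i} → ¬ ChainRel w i i
ChainRel-irrefl _ w-injective (a , b , a<b , refl , wb≡wa) =
  Fin.<⇒≢ a<b (w-injective a b (sym wb≡wa))

module FinEnumeration {n ℓ} {_≺_ : Rel (Fin n) ℓ} (≺-isStrictTotalOrder : IsStrictTotalOrder _≡_ _≺_) where
  open IsStrictTotalOrder ≺-isStrictTotalOrder
    using (compare; irrefl; asym; _<?_) renaming (trans to ≺-trans)

  Increasing : Vec (Fin n) n → Set ℓ
  Increasing w = ∀ {a b} → a <F b → lookup w a ≺ lookup w b

  increasing⇒injective : ∀ w → Increasing w → ∀ a b → lookup w a ≡ lookup w b → a ≡ b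
  increasing⇒injective w w↑ a b wa≡wb with Fin.<-cmp a b
  ... | tri< a<b _ _ = contradiction (w↑ a<b) (irrefl wa≡wb)
  ... | tri≈ _ a≡b _ = a≡b
  ... | tri> _ _ b<a = contradiction (w↑ b<a) (irrefl (sym wa≡wb))

  ChainRel⊆≺ : ∀ w → Increasing w → ∀ {i j} → ChainRel w i j → i ≺ j
  ChainRel⊆≺ w w↑ (a , b , a<b , refl , refl) = w↑ a<b

  predecessors : Fin n → Subset n
  predecessors i = tabulate λ j → does (j <? i)

  ≺⇒∈predecessors : ∀ {i j} → j ≺ i → j ∈ predecessors i
  ≺⇒∈predecessors {i} {j} j≺i =
    lookup⇒[]= j _ (trans (lookup∘tabulate _ j) (dec-true (j <? i) j≺i))

  ∈predecessors⇒≺ : ∀ {i j} → j ∈ predecessors i → j ≺ i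
  ∈predecessors⇒≺ {i} {j} j∈ =
    does⇒witness (j <? i) (trans (sym (lookup∘tabulate _ j)) ([]=⇒lookup j∈))

  ∉predecessors : ∀ i → i ∉ predecessors i
  ∉predecessors i = irrefl refl ∘ ∈predecessors⇒≺

  predecessors⊂⊤ : ∀ i → predecessors i ⊂ ⊤
  predecessors⊂⊤ i = (λ _ → ∈⊤) , i , ∈⊤ , ∉predecessors i

  predecessors-⊂ : ∀ {i j} → i ≺ j → predecessors i ⊂ predecessors j
  predecessors-⊂ {i} i≺j =
    (≺⇒∈predecessors ∘ λ k∈ → ≺-trans (∈predecessors⇒≺ k∈) i≺j) ,
    i , ≺⇒∈predecessors i≺j , ∉predecessors i

  rank : Fin n → ℕ
  rank i = ∣ predecessors i ∣

  rank<n : ∀ i → rank i <ℕ n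
  rank<n i = subst (rank i <ℕ_) (∣⊤∣≡n n) (p⊂q⇒∣p∣<∣q∣ (predecessors⊂⊤ i))

  position : Fin n → Fin n
  position i = fromℕ< (rank<n i)

  position-mono : ∀ {i j} → i ≺ j → position i <F position j
  position-mono i≺j = subst₂ _<ℕ_ (sym (Fin.toℕ-fromℕ< _)) (sym (Fin.toℕ-fromℕ< _))
                               (p⊂q⇒∣p∣<∣q∣ (predecessors-⊂ i≺j))

  position-injective : ∀ {i j} → position i ≡ position j → i ≡ j
  position-injective {i} {j} eq with compare i j
  ... | tri< i≺j _ _ = contradiction eq (Fin.<⇒≢ (position-mono i≺j))
  ... | tri≈ _ i≡j _ = i≡j
  ... | tri> _ _ j≺i = contradiction (sym eq) (Fin.<⇒≢ (position-mono j≺i))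

  position-reflects : ∀ {i j} → position i <F position j → i ≺ j
  position-reflects {i} {j} lt with compare i j
  ... | tri< i≺j _ _ = i≺j
  ... | tri≈ _ refl _ = contradiction lt (Fin.<-irrefl refl)
  ... | tri> _ _ j≺i = contradiction lt (Fin.<-asym (position-mono j≺i))

  enumerate : Vec (Fin n) n
  enumerate = tabulate λ a → proj₁ (injective⇒surjective position-injective a)

  position-enumerate : ∀ a → position (lookup enumerate a) ≡ a
  position-enumerate a = trans (cong position (lookup∘tabulate _ a))
                               (proj₂ (injective⇒surjective position-injective a))

  enumerate-position : ∀ i → lookup enumerate (position i) ≡ i
  enumerate-position i = position-injective (position-enumerate (position i))

  enumerate-increasing : Increasing enumerate
  enumerate-increasing {a} {b} a<b =
    position-reflects (subst₂ _<F_ (sym (position-enumerate a)) (sym (position-enumerate b)) a<b)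

  ≺⇒ChainRel-enumerate : ∀ {i j} → i ≺ j → ChainRel enumerate i j
  ≺⇒ChainRel-enumerate {i} {j} i≺j =
    position i , position j , position-mono i≺j , enumerate-position i , enumerate-position j

  module _ (w w′ : Vec (Fin n) n) (w↑ : Increasing w) (w′↑ : Increasing w′) where

    overtakes : ∀ {a} → (∀ {b} → b <F a → lookup w b ≡ lookup w′ b) →
                lookup w a ≢ lookup w′ a → lookup w′ a ≺ lookup w a
    overtakes {a} agree-below wa≢w′a
      with injective⇒surjective (increasing⇒injective w′ w′↑ _ _) (lookup w a)
    ... | b , w′b≡wa with Fin.<-cmp b a
    ...   | tri< b<a _ _ = contradiction (increasing⇒injective w w↑ b a (trans (agree-below b<a) w′b≡wa))
                                         (Fin.<⇒≢ b<a)
    ...   | tri≈ _ refl _ = contradiction (sym w′b≡wa) wa≢w′a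
    ...   | tri> _ _ a<b = subst (lookup w′ a ≺_) w′b≡wa (w′↑ a<b)

  increasing-unique : ∀ w w′ → Increasing w → Increasing w′ → w ≡ w′
  increasing-unique w w′ w↑ w′↑ = begin
    w                   ≡⟨ tabulate∘lookup w ⟨
    tabulate (lookup w)  ≡⟨ tabulate-cong (λ a → agree a (<-wellFounded a)) ⟩
    tabulate (lookup w′) ≡⟨ tabulate∘lookup w′ ⟩
    w′                  ∎
    where
    open ≡-Reasoning
    -- At the first index where w and w′ differ, each of the two entries is ≺-below the other.
    agree : ∀ a → Acc _<F_ a → lookup w a ≡ lookup w′ a
    agree a (acc rec) with lookup w a Fin.≟ lookup w′ a
    ... | yes eq = eq
    ... | no  ne = contradiction (overtakes w w′ w↑ w′↑ agree-below ne)
                                 (asym (overtakes w′ w w′↑ w↑ (sym ∘ agree-below) (ne ∘ sym)))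
      where
      agree-below : ∀ {b} → b <F a → lookup w b ≡ lookup w′ b
      agree-below b<a = agree _ (rec b<a)

module _ {c ℓ₁ ℓ₂} (S : StrictTotalOrder c ℓ₁ ℓ₂) (m : ℕ) where
  open Colored S m

  isPPartition-antitone : ∀ {n ℓ ℓ′} {lab : Fin n → ℙm m} {R : Fin n → Fin n → Set ℓ}
                          {R′ : Fin n → Fin n → Set ℓ′} {f : Fin n → Sm} →
                          (∀ {i j} → R i j → R′ i j) → IsPPartition lab R′ f → IsPPartition lab R f
  isPPartition-antitone R⊆R′ P = record
    { colour = colour
    ; weak   = λ i j → weak i j ∘ R⊆R′
    ; strict = λ i j → strict i j ∘ R⊆R′
    }
    where open IsPPartition P

module PartitionOrder {c ℓ₁ ℓ₂} (S : StrictTotalOrder c ℓ₁ ℓ₂) (m : ℕ) {n : ℕ}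
                      (lab : Fin n → ℙm m)
                      (lab-injective : ∀ i j → proj₁ (lab i) ≡ proj₁ (lab j) → i ≡ j)
                      (f : Fin n → Colored.Sm S m) where
  open StrictTotalOrder S using (_≈_; isStrictTotalOrder)
  open Colored S m

  Sm-isStrictTotalOrder : IsStrictTotalOrder (Pointwise _≈_ _≡_) _<Sm_
  Sm-isStrictTotalOrder = ×-isStrictTotalOrder isStrictTotalOrder Fin.<-isStrictTotalOrder

  key : Fin n → Sm × ℕ
  key i = f i , proj₁ (lab i)

  _≺_ : Rel (Fin n) _
  _≺_ = ×-Lex (Pointwise _≈_ _≡_) _<Sm_ _<ℕ_ on key

  ≺-isStrictTotalOrder : IsStrictTotalOrder _≡_ _≺_
  ≺-isStrictTotalOrder = isStrictTotalOrder-≡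
    (On.isStrictTotalOrder key (×-isStrictTotalOrder Sm-isStrictTotalOrder ℕ.<-isStrictTotalOrder))
    (lab-injective _ _ ∘ proj₂)

  open FinEnumeration ≺-isStrictTotalOrder public

  ≺⇒≤ : ∀ {i j} → i ≺ j → f i ≤Sm f j
  ≺⇒≤ (inj₁ (inj₁ s<t))        = inj₁ s<t
  ≺⇒≤ (inj₁ (inj₂ (s≈t , a<b))) = inj₂ (s≈t , inj₁ a<b)
  ≺⇒≤ (inj₂ ((s≈t , a≡b) , _))  = inj₂ (s≈t , inj₂ a≡b)

  ≺∧descent⇒< : ∀ {i j} → i ≺ j → lab j <ℙ lab i → f i <Sm f j
  ≺∧descent⇒< (inj₁ fi<fj)    _                 = fi<fj
  ≺∧descent⇒< (inj₂ (_ , l<)) (inj₁ l>)         = contradiction l> (ℕ.<-asym l<)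
  ≺∧descent⇒< (inj₂ (_ , l<)) (inj₂ (l≡ , _))   = contradiction (sym l≡) (ℕ.<⇒≢ l<)

  ≤∧descent⇒≺ : ∀ {i j} → i ≢ j → f i ≤Sm f j → (lab j <ℙ lab i → f i <Sm f j) → i ≺ j
  ≤∧descent⇒≺ _ (inj₁ s<t)                _ = inj₁ (inj₁ s<t)
  ≤∧descent⇒≺ _ (inj₂ (s≈t , inj₁ a<b)) _ = inj₁ (inj₂ (s≈t , a<b))
  ≤∧descent⇒≺ {i} {j} i≢j (inj₂ (s≈t , inj₂ a≡b)) descent with ℕ.<-cmp (proj₁ (lab i)) (proj₁ (lab j))
  ... | tri< l< _ _ = inj₂ ((s≈t , a≡b) , l<)
  ... | tri≈ _ l≡ _ = contradiction (lab-injective i j l≡) i≢j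
  ... | tri> _ _ l> = contradiction (descent (inj₁ l>))
                                    (IsStrictTotalOrder.irrefl Sm-isStrictTotalOrder (s≈t , a≡b))

  isPPartition⇒⊆≺ : ∀ {ℓ} {R : Fin n → Fin n → Set ℓ} → (∀ {i} → ¬ R i i) →
                    IsPPartition lab R f → ∀ {i j} → R i j → i ≺ j
  isPPartition⇒⊆≺ R-irrefl P {i} {j} r =
    ≤∧descent⇒≺ (λ { refl → R-irrefl r }) (weak i j r) (strict i j r)
    where open IsPPartition P

  ⊆≺⇒isPPartition : ∀ {ℓ} {R : Fin n → Fin n → Set ℓ} → (∀ i → proj₂ (f i) ≡ proj₂ (lab i)) →
                    (∀ {i j} → R i j → i ≺ j) → IsPPartition lab R f
  ⊆≺⇒isPPartition colour R⊆≺ = record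
    { colour = colour
    ; weak   = λ _ _ → ≺⇒≤ ∘ R⊆≺
    ; strict = λ _ _ → ≺∧descent⇒< ∘ R⊆≺
    }

  chain-increasing : ∀ w → (∀ a b → lookup w a ≡ lookup w b → a ≡ b) →
                     IsPPartition lab (ChainRel w) f → Increasing w
  chain-increasing w w-injective P {a} {b} a<b =
    isPPartition⇒⊆≺ (ChainRel-irrefl w w-injective) P (a , b , a<b , refl , refl)

  enumerate-isLinearExtension : ∀ {ℓ} {R : Fin n → Fin n → Set ℓ} → (∀ {i} → ¬ R i i) →
                                IsPPartition lab R f → IsLinearExtension R enumerate
  enumerate-isLinearExtension R-irrefl P = record
    { injective = increasing⇒injective enumerate enumerate-increasing
    ; extends   = λ _ _ → ≺⇒ChainRel-enumerate ∘ isPPartition⇒⊆≺ R-irrefl P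
    }

  enumerate-isPPartition : (∀ i → proj₂ (f i) ≡ proj₂ (lab i)) → IsPPartition lab (ChainRel enumerate) f
  enumerate-isPPartition colour = ⊆≺⇒isPPartition colour (ChainRel⊆≺ enumerate enumerate-increasing)

  chain-partition-unique : ∀ w w′ → (∀ a b → lookup w a ≡ lookup w b → a ≡ b) →
                           (∀ a b → lookup w′ a ≡ lookup w′ b → a ≡ b) →
                           IsPPartition lab (ChainRel w) f → IsPPartition lab (ChainRel w′) f → w ≡ w′
  chain-partition-unique w w′ w-injective w′-injective P P′ =
    increasing-unique w w′ (chain-increasing w w-injective P) (chain-increasing w′ w′-injective P′)

mainTheorem5 : ∀ {c ℓ₁ ℓ₂ ℓ} (m : ℕ) → 1 ≤ m →
    (S : StrictTotalOrder c ℓ₁ ℓ₂) →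
    (Σ (StrictTotalOrder.Carrier S → ℕ) λ g → ∀ x y → g x ≡ g y → StrictTotalOrder._≈_ S x y) →
    (n : ℕ) (lab : Fin n → ℙm m) (R : Fin n → Fin n → Set ℓ) → IsColoredPoset m lab R →
    ((f : Fin n → Colored.Sm S m) → Colored.IsPPartition S m lab R f →
       Σ (Vec (Fin n) n) λ w → IsLinearExtension R w × Colored.IsPPartition S m lab (ChainRel w) f)
    × ((f : Fin n → Colored.Sm S m) (w w′ : Vec (Fin n) n) →
       IsLinearExtension R w → IsLinearExtension R w′ →
       Colored.IsPPartition S m lab (ChainRel w) f → Colored.IsPPartition S m lab (ChainRel w′) f →
       w ≡ w′)
    × ((f : Fin n → Colored.Sm S m) (w : Vec (Fin n) n) → IsLinearExtension R w →
       Colored.IsPPartition S m lab (ChainRel w) f → Colored.IsPPartition S m lab R f)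
mainTheorem5 m _ S _ n lab R poset =
    (λ f P → let open PartitionOrder S m lab distinct f in
       enumerate , enumerate-isLinearExtension R-irrefl P , enumerate-isPPartition (colour P))
  , (λ f w w′ L L′ → PartitionOrder.chain-partition-unique S m lab distinct f w w′ (injective L) (injective L′))
  , (λ f w L → isPPartition-antitone S m (extends L _ _))
  where
  open IsColoredPoset poset using (distinct; partial)
  open IsLinearExtension using (injective; extends)
  open Colored.IsPPartition using (colour)

  R-irrefl : ∀ {i} → ¬ R i i
  R-irrefl = IsStrictPartialOrder.irrefl partial refl
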